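{- Let $\mathcal{C}$ be any of temporalisation $\mathcal{L}$, probabilisation $\mathcal{P}$ or hybridisation $\mathcal{H}$. If $(\Phi,\alpha,\beta):\mathcal{I}\to\mathcal{I}'$ is a conservative comorphism, then the lifted comorphism $\mathcal{C}(\Phi,\alpha,\beta):\mathcal{C}\mathcal{I}\to\mathcal{C}\mathcal{I}'$ is conservative.
   Context: Institutions $\mathcal{I}=(Sign^{\mathcal{I}},Sen^{\mathcal{I}},Mod^{\mathcal{I}},\models)$ and comorphisms $(\Phi,\alpha,\beta)$ (functor $\Phi$ on signatures, natural $\alpha:Sen^{\mathcal{I}}\Rightarrow Sen^{\mathcal{I}'}\circ\Phi$, natural $\beta:Mod^{\mathcal{I}'}\circ\Phi^{op}\Rightarrow Mod^{\mathcal{I}}$, with $\beta_\Sigma(M)\models\rho$ iff $M\models\alpha_\Sigma(\rho)$) are as usual. A comorphism is conservative if every $\beta_\Sigma$ is surjective on objects. For each $\mathcal{C}\in\{\mathcal{L},\mathcal{P},\mathcal{H}\}$, the signatures of $\mathcal{C}\mathcal{I}$ are pairs $(\Delta,\Sigma)$ with $\Sigma$ an $\mathcal{I}$-signature and $\Delta$ a top-level signature (only one for $\mathcal{L},\mathcal{P}$; a pair $(Nom,\Lambda)$ of sets of nominals and modalities for $\mathcal{H}$), and $Mod^{\mathcal{C}\mathcal{I}}(\Delta,\Sigma)$ is a discrete category whose objects are all triples $(S,R,m)$ with $R$ a top-level structure on the set $S$ and $m:S\to|Mod^{\mathcal{I}}(\Sigma)|$ an arbitrary function: for $\mathcal{L}$,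 $S=\mathbb{N}$ and $R$ is the successor function; for $\mathcal{P}$, $R=p:2^S\to[0,1]$ a probability measure; for $\mathcal{H}$, $R=((R_i)_{i\in Nom},(R_\lambda)_{\lambda\in\Lambda})$ with $R_i\in S$, $R_\lambda\subseteq S\times S$. Sentences of $\mathcal{C}\mathcal{I}$ are: for $\mathcal{L}$, $\rho::=\psi\mid\neg\rho\mid\rho\wedge\rho\mid X\rho\mid\rho U\rho$; for $\mathcal{P}$, $\rho::=t<t\mid\neg\rho\mid\rho\wedge\rho$ with terms $t::=r\mid\int\psi\mid t+t\mid t.t$ ($r\in\mathbb{R}$); for $\mathcal{H}$, $\rho::=i\mid\psi\mid\neg\rho\mid\rho\wedge\rho\mid@_i\rho\mid\langle\lambda\rangle\rho$; always $\psi\in Sen^{\mathcal{I}}(\Sigma)$. Satisfaction: for $\mathcal{L}$, $M\models\rho$ iff $M\models^0\rho$ with $M\models^j\psi$ iff $m(j)\models\psi$, $M\models^jX\rho$ iff $M\models^{j+1}\rho$, $M\models^j\rho U\rho'$ iff some $k\ge j$ has $M\models^k\rho'$ and $M\models^i\rho$ for $j\le i<k$; for $\mathcal{P}$, $M\models t<t'$ iff $M_t<M_{t'}$ where $M_r=r$, $M_{\int\psi}=p(\{s:m(s)\models\psi\})$, $+$ and $.$ interpreted as real addition and multiplication; for $\mathcal{H}$, $M\models\rho$ iff $M\models^w\rho$ for all $w\in S$, where $M\models^wi$ iff $R_i=w$, $M\models^w\psi$ iff $m(w)\models\psi$, $M\models^w@_i\rho$ iff $M\models^{R_i}\rho$,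 $M\models^w\langle\lambda\rangle\rho$ iff $M\models^{w'}\rho$ for some $w'$ with $(w,w')\in R_\lambda$; Boolean connectives as usual in all cases. The lifted comorphism $\mathcal{C}(\Phi,\alpha,\beta)=(\mathcal{C}\Phi,\mathcal{C}\alpha,\mathcal{C}\beta)$ is given by $\mathcal{C}\Phi(\Delta,\Sigma)=(\Delta,\Phi(\Sigma))$ (identity on the top component), $(\mathcal{C}\alpha)_{(\Delta,\Sigma)}(\rho)=\rho$ with every base sentence $\psi$ replaced by $\alpha_\Sigma(\psi)$, and $(\mathcal{C}\beta)_{(\Delta,\Sigma)}(S,R,m)=(S,R,\beta_\Sigma\circ m)$. -}

module Defs where

open import Level using (Level; _⊔_; Lift) renaming (suc to lsuc)
open import Data.Nat using (ℕ)
open import Data.Bool using (Bool; true; false; _∧_; _∨_)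
open import Data.Unit.Polymorphic using (⊤)
open import Data.Product using (Σ; Σ-syntax; _×_; _,_; proj₁; proj₂)
open import Function using (_∘′_)
open import Relation.Binary.PropositionalEquality using (_≡_; subst; subst₂)

record Category (o a : Level) : Set (lsuc (o ⊔ a)) where
  infixr 9 _∘_
  field
    Obj   : Set o
    Hom   : Obj → Obj → Set a
    id    : ∀ {A} → Hom A A
    _∘_   : ∀ {A B C} → Hom B C → Hom A B → Hom A C
    idˡ   : ∀ {A B} (f : Hom A B) → id ∘ f ≡ f
    idʳ   : ∀ {A B} (f : Hom A B) → f ∘ id ≡ f
    assoc : ∀ {A B C D} (h : Hom C D) (g : Hom B C) (f : Hom A B) →
            (h ∘ g) ∘ f ≡ h ∘ (g ∘ f)

open Category

record Functor {o a o′ a′} (C : Category o a) (D : Category o′ a′)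
       : Set (o ⊔ a ⊔ o′ ⊔ a′) where
  field
    F₀   : Obj C → Obj D
    F₁   : ∀ {A B} → Hom C A B → Hom D (F₀ A) (F₀ B)
    F-id : ∀ {A} → F₁ (id C {A}) ≡ id D
    F-∘  : ∀ {A B E} (g : Hom C B E) (f : Hom C A B) →
           F₁ (_∘_ C g f) ≡ _∘_ D (F₁ g) (F₁ f)

open Functor

_⇔′_ : ∀ {p q} → Set p → Set q → Set (p ⊔ q)
A ⇔′ B = (A → B) × (B → A)

record Institution (o a s m h t : Level)
       : Set (lsuc (o ⊔ a ⊔ s ⊔ m ⊔ h ⊔ t)) where
  field
    Sig     : Category o a
    Sen     : Obj Sig → Set s
    sen     : ∀ {Σ₁ Σ₂} → Hom Sig Σ₁ Σ₂ → Sen Σ₁ → Sen Σ₂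
    sen-id  : ∀ {Σ₁} (ρ : Sen Σ₁) → sen (id Sig) ρ ≡ ρ
    sen-∘   : ∀ {Σ₁ Σ₂ Σ₃} (g : Hom Sig Σ₂ Σ₃) (f : Hom Sig Σ₁ Σ₂) (ρ : Sen Σ₁) →
              sen (_∘_ Sig g f) ρ ≡ sen g (sen f ρ)
    Mod     : Obj Sig → Category m h
    reduct  : ∀ {Σ₁ Σ₂} → Hom Sig Σ₁ Σ₂ → Functor (Mod Σ₂) (Mod Σ₁)
    reduct-id₀ : ∀ {Σ₁} (M : Obj (Mod Σ₁)) → F₀ (reduct (id Sig)) M ≡ M
    reduct-id₁ : ∀ {Σ₁} {M N : Obj (Mod Σ₁)} (f : Hom (Mod Σ₁) M N) →
                 subst₂ (Hom (Mod Σ₁)) (reduct-id₀ M) (reduct-id₀ N)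
                        (F₁ (reduct (id Sig)) f) ≡ f
    reduct-∘₀ : ∀ {Σ₁ Σ₂ Σ₃} (g : Hom Sig Σ₂ Σ₃) (f : Hom Sig Σ₁ Σ₂)
                (M : Obj (Mod Σ₃)) →
                F₀ (reduct (_∘_ Sig g f)) M ≡ F₀ (reduct f) (F₀ (reduct g) M)
    reduct-∘₁ : ∀ {Σ₁ Σ₂ Σ₃} (g : Hom Sig Σ₂ Σ₃) (f : Hom Sig Σ₁ Σ₂)
                {M N : Obj (Mod Σ₃)} (k : Hom (Mod Σ₃) M N) →
                subst₂ (Hom (Mod Σ₁)) (reduct-∘₀ g f M) (reduct-∘₀ g f N)
                       (F₁ (reduct (_∘_ Sig g f)) k)
                ≡ F₁ (reduct f) (F₁ (reduct g) k)
    _⊨_     : ∀ {Σ₁} → Obj (Mod Σ₁) → Sen Σ₁ → Set t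
    sat     : ∀ {Σ₁ Σ₂} (σ : Hom Sig Σ₁ Σ₂) (M : Obj (Mod Σ₂)) (ρ : Sen Σ₁) →
              (F₀ (reduct σ) M ⊨ ρ) ⇔′ (M ⊨ sen σ ρ)

record Comorphism {o a s m h t o′ a′ s′ m′ h′ t′ : Level}
       (I : Institution o a s m h t) (I′ : Institution o′ a′ s′ m′ h′ t′)
       : Set (o ⊔ a ⊔ s ⊔ m ⊔ h ⊔ t ⊔ o′ ⊔ a′ ⊔ s′ ⊔ m′ ⊔ h′ ⊔ t′) where
  private
    module I  = Institution I
    module I′ = Institution I′
  field
    Φ     : Functor I.Sig I′.Sig
    α     : ∀ Σ₁ → I.Sen Σ₁ → I′.Sen (F₀ Φ Σ₁)
    α-nat : ∀ {Σ₁ Σ₂} (σ : Hom I.Sig Σ₁ Σ₂) (ρ : I.Sen Σ₁) →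
            α Σ₂ (I.sen σ ρ) ≡ I′.sen (F₁ Φ σ) (α Σ₁ ρ)
    β     : ∀ Σ₁ → Functor (I′.Mod (F₀ Φ Σ₁)) (I.Mod Σ₁)
    β-nat₀ : ∀ {Σ₁ Σ₂} (σ : Hom I.Sig Σ₁ Σ₂) (M : Obj (I′.Mod (F₀ Φ Σ₂))) →
             F₀ (β Σ₁) (F₀ (I′.reduct (F₁ Φ σ)) M) ≡ F₀ (I.reduct σ) (F₀ (β Σ₂) M)
    β-nat₁ : ∀ {Σ₁ Σ₂} (σ : Hom I.Sig Σ₁ Σ₂) {M N : Obj (I′.Mod (F₀ Φ Σ₂))}
             (k : Hom (I′.Mod (F₀ Φ Σ₂)) M N) →
             subst₂ (Hom (I.Mod Σ₁)) (β-nat₀ σ M) (β-nat₀ σ N)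
                    (F₁ (β Σ₁) (F₁ (I′.reduct (F₁ Φ σ)) k))
             ≡ F₁ (I.reduct σ) (F₁ (β Σ₂) k)
    sat   : ∀ Σ₁ (M : Obj (I′.Mod (F₀ Φ Σ₁))) (ρ : I.Sen Σ₁) →
            I._⊨_ (F₀ (β Σ₁) M) ρ ⇔′ I′._⊨_ M (α Σ₁ ρ)

Conservative : ∀ {o a s m h t o′ a′ s′ m′ h′ t′}
  {I : Institution o a s m h t} {I′ : Institution o′ a′ s′ m′ h′ t′} →
  Comorphism I I′ → Set (o ⊔ m ⊔ m′)
Conservative {I = I} {I′} χ =
  ∀ Σ₁ (M : Obj (Institution.Mod I Σ₁)) →
  Σ[ M′ ∈ Obj (Institution.Mod I′ (F₀ (Comorphism.Φ χ) Σ₁)) ]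
    F₀ (Comorphism.β χ Σ₁) M′ ≡ M

record Reals : Set₁ where
  field
    ℝ    : Set
    0ℝ   : ℝ
    1ℝ   : ℝ
    _+ℝ_ : ℝ → ℝ → ℝ
    _≤ℝ_ : ℝ → ℝ → Set

data Construction : Set where
  𝓛 𝓟 𝓗 : Construction

-- top-level signatures: unique one for 𝓛, 𝓟; (Nom, Λ) for 𝓗
TopSig : (ℓ : Level) → Construction → Set (lsuc ℓ)
TopSig ℓ 𝓛 = ⊤
TopSig ℓ 𝓟 = ⊤
TopSig ℓ 𝓗 = Set ℓ × Set ℓ

-- probability measure on 2^S (subsets as characteristic functions)
record ProbStr (ℛ : Reals) {ℓ : Level} (S : Set ℓ) : Set ℓ where
  open Reals ℛ
  field
    p       : (S → Bool) → ℝ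
    p-≥0    : ∀ A → 0ℝ ≤ℝ p A
    p-≤1    : ∀ A → p A ≤ℝ 1ℝ
    p-total : p (λ _ → true) ≡ 1ℝ
    p-add   : ∀ A B → (∀ x → A x ∧ B x ≡ false) →
              p (λ x → A x ∨ B x) ≡ p A +ℝ p B

record HybStr {ℓ : Level} (Δ : Set ℓ × Set ℓ) (S : Set ℓ) : Set (lsuc ℓ) where
  field
    Rnom : proj₁ Δ → S
    Rmod : proj₂ Δ → S → S → Set ℓ

TopStr : (ℛ : Reals) (ℓ : Level) (C : Construction) → TopSig ℓ C → Set (lsuc ℓ)
TopStr ℛ ℓ 𝓛 _ = ⊤ {lsuc ℓ}   -- S = ℕ, R = successor (fixed)
TopStr ℛ ℓ 𝓟 _ = Σ[ S ∈ Set ℓ ] ProbStr ℛ S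
TopStr ℛ ℓ 𝓗 Δ = Σ[ S ∈ Set ℓ ] HybStr Δ S

carrier : ∀ {ℛ ℓ} (C : Construction) {Δ : TopSig ℓ C} → TopStr ℛ ℓ C Δ → Set ℓ
carrier {ℓ = ℓ} 𝓛 _ = Lift ℓ ℕ
carrier 𝓟 (S , _) = S
carrier 𝓗 (S , _) = S

-- Objects of Mod^{C I}(Δ, Σ): triples (S, R, m) with m : S → |Mod^I(Σ)|
CModel : ∀ {o a s m h t} (ℛ : Reals) (ℓ : Level) (I : Institution o a s m h t)
         (C : Construction) (Δ : TopSig ℓ C) (Σ₁ : Obj (Institution.Sig I)) →
         Set (lsuc ℓ ⊔ m)
CModel ℛ ℓ I C Δ Σ₁ =
  Σ[ R ∈ TopStr ℛ ℓ C Δ ] (carrier C R → Obj (Institution.Mod I Σ₁))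

_≈CM_ : ∀ {o a s m h t ℛ ℓ} {I : Institution o a s m h t} {C Δ Σ₁} →
        CModel ℛ ℓ I C Δ Σ₁ → CModel ℛ ℓ I C Δ Σ₁ → Set (lsuc ℓ ⊔ m)
_≈CM_ {C = C} (R , f) (R′ , g) =
  Σ[ e ∈ R ≡ R′ ] (∀ x → f x ≡ g (subst (carrier C) e x))

liftβ : ∀ {o a s m h t o′ a′ s′ m′ h′ t′}
  {I : Institution o a s m h t} {I′ : Institution o′ a′ s′ m′ h′ t′}
  (ℛ : Reals) (ℓ : Level) (χ : Comorphism I I′) (C : Construction)
  (Δ : TopSig ℓ C) (Σ₁ : Obj (Institution.Sig I)) →
  CModel ℛ ℓ I′ C Δ (F₀ (Comorphism.Φ χ) Σ₁) → CModel ℛ ℓ I C Δ Σ₁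
liftβ ℛ ℓ χ C Δ Σ₁ (R , f) = R , (F₀ (Comorphism.β χ Σ₁) ∘′ f)

LiftedConservative : ∀ {o a s m h t o′ a′ s′ m′ h′ t′}
  {I : Institution o a s m h t} {I′ : Institution o′ a′ s′ m′ h′ t′}
  (ℛ : Reals) (ℓ : Level) (χ : Comorphism I I′) (C : Construction) →
  Set (lsuc ℓ ⊔ o ⊔ m ⊔ m′)
LiftedConservative {I = I} {I′} ℛ ℓ χ C =
  ∀ (Δ : TopSig ℓ C) (Σ₁ : Obj (Institution.Sig I))
    (M : CModel ℛ ℓ I C Δ Σ₁) →
  Σ[ M′ ∈ CModel ℛ ℓ I′ C Δ (F₀ (Comorphism.Φ χ) Σ₁) ]
    _≈CM_ {I = I} (liftβ ℛ ℓ χ C Δ Σ₁ M′) M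

module Submission where

open import Defs
open import Level using (Level)
open import Data.Product using (Σ-syntax; _,_; proj₁; proj₂)
open import Relation.Binary.PropositionalEquality using (_≡_; refl)

-- Cβ leaves the top-level structure (S, R) untouched and acts on m by
-- postcomposition with β, so each local model m(w) is lifted independently;
-- no choice principle is needed since conservativity supplies the preimages.

postcompose-surjective : ∀ {a b c} {A : Set a} {B : Set b} {X : Set c}
  (g : A → B) → (∀ y → Σ[ x ∈ A ] g x ≡ y) →
  ∀ (f : X → B) → Σ[ h ∈ (X → A) ] (∀ x → g (h x) ≡ f x)
postcompose-surjective g g-onto f =
  (λ x → proj₁ (g-onto (f x))) , (λ x → proj₂ (g-onto (f x)))

theorem4 : ∀ {o a s m h t o′ a′ s′ m′ h′ t′ : Level}
    {I : Institution o a s m h t} {I′ : Institution o′ a′ s′ m′ h′ t′}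
    (ℛ : Reals) (ℓ : Level) (C : Construction) (χ : Comorphism I I′) →
    Conservative χ → LiftedConservative ℛ ℓ χ C
theorem4 ℛ ℓ C χ conservative Δ Σ₁ (R , m)
  with postcompose-surjective _ (conservative Σ₁) m
... | m′ , β∘m′≗m = (R , m′) , refl , β∘m′≗m
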